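{- An integer $n$ is a special Carmichael number if and only if $n$ is odd, square-free, and $(p-1) \mid \frac{n-1}{2}$ for every prime $p$ dividing $n$.
   Context: An odd composite number $n$ is called a special Carmichael number if $a^{\frac{n-1}{2}} \equiv 1 \pmod n$ for all $a \in U(\mathbb{Z}_n)=\{a\in\mathbb{Z}_n \mid \gcd(a,n)=1\}$. -}

module Defs where

open import Data.Nat using (ℕ; suc; _∸_; _^_; _<_; _*_)
open import Data.Nat.DivMod using (_/_; _%_)
open import Data.Nat.Divisibility using (_∣_)
open import Data.Nat.GCD using (gcd)
open import Data.Nat.Primality using (Composite; Prime)
open import Data.Product using (_×_; ∃)
open import Relation.Binary.PropositionalEquality using (_≡_)
open import Relation.Nullary using (¬_)

Odd : ℕ → Set
Odd n = ¬ (2 ∣ n)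

SquareFree : ℕ → Set
SquareFree n = ∀ d → 1 < d → ¬ (d * d ∣ n)

-- Special Carmichael number (paper's definition): odd composite n with
-- a^((n-1)/2) ≡ 1 (mod n) for every a ∈ U(Z_n), i.e. every a with 0 ≤ a < n, gcd(a,n)=1.
SpecialCarmichael : ℕ → Set
SpecialCarmichael n =
  Odd n × Composite n ×
  (∀ a → a < n → gcd a n ≡ 1 → (a ^ ((n ∸ 1) / 2)) % suc (n ∸ 1) ≡ 1)

module Submission where

open import Defs
open import Data.Nat using (ℕ; _∸_)
open import Data.Nat.DivMod using (_/_)
open import Data.Nat.Divisibility using (_∣_)
open import Data.Nat.Primality using (Composite; Prime)
open import Data.Product using (_×_)
open import Function.Bundles using (_⇔_)
open import Data.Nat using (zero; suc; _<_; nonTrivial⇒n>1)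
open import Data.Nat.Primality using (composite⇒nonTrivial)
open import Data.Nat.Divisibility using (hasNonTrivialDivisor)
open import Data.Product using (_,_)
open import Function.Bundles using (mk⇔)

-- Write N = 2k + 1.  By definition N is a special Carmichael number iff N is odd,
-- composite and k is an exponent of the unit group U(ℤ_N), i.e. aᵏ ≡ 1 (mod N)
-- for every unit a.
--
--  * squarefree: if d² ∣ N, the unit 1 + N/d has (1 + N/d)ᵏ ≡ 1 + k·N/d, so
--    d ∣ k; as d also divides N = 2k + 1 it follows that d = 1;
--  * p − 1 ∣ k for p ∣ N: if N = m·p with p ∤ m, each 0 < a < p is congruent
--    modulo p to the unit 1 + (a − 1)·m^(p−1) of ℤ_N, so aᵏ ≡ 1 (mod p); and if
--    p − 1 ∤ k, Lagrange's bound on the roots of X^(k mod (p−1)) − 1 modulo p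
--    is violated by the p − 1 residues 1, …, p − 1;
--  * conversely, Fermat's little theorem gives p ∣ aᵏ − 1 for each prime p ∣ N,
--    and N, being squarefree, is the product of these primes.

module Arithmetic where

  open import Data.Nat
    using (_+_; _*_; _^_; _%_; _!; _≤_; z≤n; s≤s; NonZero; ≢-nonZero; >-nonZero)
  open import Data.Nat.Properties
  open import Data.Nat.DivMod
  open import Data.Nat.Divisibility using (divides; ∣1⇒≡1; ∣⇒≤; n∣m⇒m%n≡0; ∣m∣n⇒∣m+n; ∣m⇒∣m*n; m∣m*n)
  open import Data.Nat.Combinatorics using (_C_; nCn≡1; k![n∸k]!∣n!)
  open import Data.Nat.Combinatorics.Specification using (nCk≡n!/k![n-k]!)
  open import Data.Nat.Primality using (prime⇒nonZero; prime⇒nonTrivial; euclidsLemma)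
  open import Data.Fin using (Fin; zero; suc; toℕ; inject₁; fromℕ)
  open import Data.Fin.Properties using (toℕ<n; toℕ-inject₁; toℕ-fromℕ)
  open import Data.Vec.Functional using (init; tail)
  open import Data.Sum using (inj₁; inj₂)
  open import Relation.Nullary using (¬_; contradiction)
  open import Relation.Binary.PropositionalEquality
  open ≡-Reasoning

  import Algebra.Properties.CommutativeSemiring.Binomial as Binomial
  open Binomial +-*-commutativeSemiring using (theorem; binomialTerm)
  open import Algebra.Properties.Monoid.Sum +-0-monoid using (sum; sum-init-last)
  import Algebra.Properties.Semiring.Exp +-*-semiring as Exp
  import Algebra.Properties.Semiring.Mult +-*-semiring as Mult

  infix 4 _≡_modulo_
  _≡_modulo_ : ℕ → ℕ → (n : ℕ) .{{_ : NonZero n}} → Set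
  _≡_modulo_ x y n = x % n ≡ y % n

  module _ {n : ℕ} .{{_ : NonZero n}} where

    modulo-+ : ∀ {a a′ b b′} → a ≡ a′ modulo n → b ≡ b′ modulo n → a + b ≡ a′ + b′ modulo n
    modulo-+ {a} {a′} {b} {b′} a≡a′ b≡b′ = begin
      (a + b) % n           ≡⟨ %-distribˡ-+ a b n ⟩
      (a % n + b % n) % n   ≡⟨ cong₂ (λ u v → (u + v) % n) a≡a′ b≡b′ ⟩
      (a′ % n + b′ % n) % n ≡⟨ %-distribˡ-+ a′ b′ n ⟨
      (a′ + b′) % n         ∎

    modulo-* : ∀ {a a′ b b′} → a ≡ a′ modulo n → b ≡ b′ modulo n → a * b ≡ a′ * b′ modulo n
    modulo-* {a} {a′} {b} {b′} a≡a′ b≡b′ = begin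
      (a * b) % n             ≡⟨ %-distribˡ-* a b n ⟩
      (a % n * (b % n)) % n   ≡⟨ cong₂ (λ u v → (u * v) % n) a≡a′ b≡b′ ⟩
      (a′ % n * (b′ % n)) % n ≡⟨ %-distribˡ-* a′ b′ n ⟨
      (a′ * b′) % n           ∎

    modulo-^ : ∀ {a b} → a ≡ b modulo n → ∀ k → a ^ k ≡ b ^ k modulo n
    modulo-^ a≡b zero    = refl
    modulo-^ a≡b (suc k) = modulo-* a≡b (modulo-^ a≡b k)

    modulo⇒∣∸ : ∀ {x y} → x ≡ y modulo n → n ∣ x ∸ y
    modulo⇒∣∸ {x} {y} x≡y = divides (x / n ∸ y / n) (begin
      x ∸ y                                     ≡⟨ cong₂ _∸_ (m≡m%n+[m/n]*n x n) (m≡m%n+[m/n]*n y n) ⟩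
      (x % n + x / n * n) ∸ (y % n + y / n * n) ≡⟨ cong (λ r → (r + x / n * n) ∸ (y % n + y / n * n)) x≡y ⟩
      (y % n + x / n * n) ∸ (y % n + y / n * n) ≡⟨ [m+n]∸[m+o]≡n∸o (y % n) (x / n * n) (y / n * n) ⟩
      x / n * n ∸ y / n * n                     ≡⟨ *-distribʳ-∸ n (x / n) (y / n) ⟨
      (x / n ∸ y / n) * n                       ∎)

    ∣∸⇒modulo : ∀ {x y} → y ≤ x → n ∣ x ∸ y → x ≡ y modulo n
    ∣∸⇒modulo {x} {y} y≤x n∣x∸y = begin
      x % n             ≡⟨ cong (_% n) (m+[n∸m]≡n y≤x) ⟨
      (y + (x ∸ y)) % n ≡⟨ %-remove-+ʳ y n∣x∸y ⟩
      y % n             ∎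

    modulo-∣ : ∀ {d x y} .{{_ : NonZero d}} → d ∣ n → x ≡ y modulo n → x ≡ y modulo d
    modulo-∣ {d} {x} {y} d∣n x≡y = begin
      x % d     ≡⟨ m∣n⇒o%n%m≡o%m d n x d∣n ⟨
      x % n % d ≡⟨ cong (_% d) x≡y ⟩
      y % n % d ≡⟨ m∣n⇒o%n%m≡o%m d n y d∣n ⟩
      y % d     ∎

    -- A remainder equal to 1 forces n > 1, so that 1 is its own remainder.
    %≡1⇒≡1 : ∀ {x} → x % n ≡ 1 → x ≡ 1 modulo n
    %≡1⇒≡1 {x} x%n≡1 = trans x%n≡1 (sym (m<n⇒m%n≡m (subst (_< n) x%n≡1 (m%n<n x n))))

  exp≡^ : ∀ x k → x Exp.^ k ≡ x ^ k
  exp≡^ x zero    = refl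
  exp≡^ x (suc k) = cong (x *_) (exp≡^ x k)

  mult≡* : ∀ k x → k Mult.× x ≡ k * x
  mult≡* zero    x = refl
  mult≡* (suc k) x = cong (x +_) (mult≡* k x)

  binomialTerm≡ : ∀ x n (k : Fin (suc n)) → binomialTerm x 1 n k ≡ (n C toℕ k) * x ^ toℕ k
  binomialTerm≡ x n k = begin
    c Mult.× (x Exp.^ toℕ k * 1 Exp.^ (n ∸ toℕ k)) ≡⟨ mult≡* c _ ⟩
    c * (x Exp.^ toℕ k * 1 Exp.^ (n ∸ toℕ k))      ≡⟨ cong₂ (λ u v → c * (u * v)) (exp≡^ x (toℕ k)) 1ᵉ≡1 ⟩
    c * (x ^ toℕ k * 1)                             ≡⟨ cong (c *_) (*-identityʳ _) ⟩
    c * x ^ toℕ k                                   ∎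
    where
    c : ℕ
    c = n C toℕ k

    1ᵉ≡1 : 1 Exp.^ (n ∸ toℕ k) ≡ 1
    1ᵉ≡1 = trans (exp≡^ 1 (n ∸ toℕ k)) (^-zeroˡ (n ∸ toℕ k))

  ∣-sum : ∀ {d m} (t : Fin m → ℕ) → (∀ i → d ∣ t i) → d ∣ sum t
  ∣-sum {m = zero}  t d∣t = divides 0 refl
  ∣-sum {m = suc m} t d∣t = ∣m∣n⇒∣m+n (d∣t zero) (∣-sum (tail t) (λ i → d∣t (suc i)))

  inner-binomials⇒freshman : ∀ {d} .{{_ : NonZero d}} n .{{_ : NonZero n}} →
    (∀ k → 0 < k → k < n → d ∣ n C k) → ∀ x → (x + 1) ^ n ≡ x ^ n + 1 modulo d
  inner-binomials⇒freshman {d} n@(suc m) d∣inner x = begin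
    (x + 1) ^ n % d           ≡⟨ cong (_% d) expansion ⟩
    (inner + (x ^ n + 1)) % d ≡⟨ %-remove-+ˡ (x ^ n + 1) (∣-sum innerTerms d∣innerTerm) ⟩
    (x ^ n + 1) % d           ∎
    where
    term : Fin (suc n) → ℕ
    term = binomialTerm x 1 n

    innerTerms : Fin m → ℕ
    innerTerms = init (tail term)

    inner : ℕ
    inner = sum innerTerms

    d∣innerTerm : ∀ i → d ∣ innerTerms i
    d∣innerTerm i = subst (d ∣_) (sym (binomialTerm≡ x n (suc (inject₁ i))))
      (∣m⇒∣m*n _ (d∣inner _ (s≤s z≤n) (s≤s (subst (_< m) (sym (toℕ-inject₁ i)) (toℕ<n i)))))

    lastTerm : term (suc (fromℕ m)) ≡ x ^ n
    lastTerm = begin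
      term (suc (fromℕ m))                                 ≡⟨ binomialTerm≡ x n (suc (fromℕ m)) ⟩
      (n C suc (toℕ (fromℕ m))) * x ^ suc (toℕ (fromℕ m)) ≡⟨ cong (λ k → (n C suc k) * x ^ suc k) (toℕ-fromℕ m) ⟩
      (n C n) * x ^ n                                      ≡⟨ cong (_* x ^ n) (nCn≡1 n) ⟩
      1 * x ^ n                                            ≡⟨ *-identityˡ _ ⟩
      x ^ n                                                ∎

    expansion : (x + 1) ^ n ≡ inner + (x ^ n + 1)
    expansion = begin
      (x + 1) ^ n                        ≡⟨ exp≡^ (x + 1) n ⟨
      (x + 1) Exp.^ n                    ≡⟨ theorem n x 1 ⟩
      term zero + sum (tail term)        ≡⟨ cong₂ _+_ (binomialTerm≡ x n zero) (sum-init-last (tail term)) ⟩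
      1 + (inner + term (suc (fromℕ m))) ≡⟨ cong (λ y → 1 + (inner + y)) lastTerm ⟩
      1 + (inner + x ^ n)                ≡⟨ +-comm 1 (inner + x ^ n) ⟩
      inner + x ^ n + 1                  ≡⟨ +-assoc inner (x ^ n) 1 ⟩
      inner + (x ^ n + 1)                ∎

  module ModPrime {p : ℕ} (prime-p : Prime p) where

    instance
      p≢0 : NonZero p
      p≢0 = prime⇒nonZero prime-p

    1<p : 1 < p
    1<p = nonTrivial⇒n>1 p {{prime⇒nonTrivial prime-p}}

    instance
      p∸1≢0 : NonZero (p ∸ 1)
      p∸1≢0 = >-nonZero (m<n⇒0<n∸m 1<p)

    p≡1+[p∸1] : p ≡ suc (p ∸ 1)
    p≡1+[p∸1] = sym (suc-pred p)

    p∤1 : ¬ p ∣ 1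
    p∤1 p∣1 = <⇒≢ 1<p (sym (∣1⇒≡1 p∣1))

    -- p divides no m! with m < p, as every factor of m! is smaller than p.
    p∤! : ∀ {m} → m < p → ¬ p ∣ m !
    p∤! {zero}  _    = p∤1
    p∤! {suc m} m<p p∣m! with euclidsLemma (suc m) (m !) prime-p p∣m!
    ... | inj₁ p∣1+m = <⇒≱ m<p (∣⇒≤ p∣1+m)
    ... | inj₂ p∣m!′ = p∤! (<-trans (n<1+n m) m<p) p∣m!′

    p∣pCk·k!·[p∸k]! : ∀ {k} → k ≤ p → p ∣ (p C k) * (k ! * (p ∸ k) !)
    p∣pCk·k!·[p∸k]! {k} k≤p = subst (p ∣_) (sym p!≡) p∣p!
      where
      instance
        k![p∸k]!≢0 : NonZero (k ! * (p ∸ k) !)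
        k![p∸k]!≢0 = k !* (p ∸ k) !≢0

      p!≡ : (p C k) * (k ! * (p ∸ k) !) ≡ p !
      p!≡ = begin
        (p C k) * (k ! * (p ∸ k) !)                   ≡⟨ cong (_* (k ! * (p ∸ k) !)) (nCk≡n!/k![n-k]! k≤p) ⟩
        (p ! / (k ! * (p ∸ k) !)) * (k ! * (p ∸ k) !) ≡⟨ m/n*n≡m (k![n∸k]!∣n! k≤p) ⟩
        p !                                           ∎

      p∣p! : p ∣ p !
      p∣p! = subst (λ n → n ∣ n !) (sym p≡1+[p∸1]) (m∣m*n ((p ∸ 1) !))

    -- Hence p divides the inner binomial coefficients p C k (0 < k < p), since it
    -- divides neither k! nor (p ∸ k)!.
    p∣pCk : ∀ {k} → 0 < k → k < p → p ∣ p C k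
    p∣pCk {k} 0<k k<p with euclidsLemma (p C k) (k ! * (p ∸ k) !) prime-p (p∣pCk·k!·[p∸k]! (<⇒≤ k<p))
    ... | inj₁ p∣pCk′ = p∣pCk′
    ... | inj₂ p∣k![p∸k]! with euclidsLemma (k !) ((p ∸ k) !) prime-p p∣k![p∸k]!
    ...   | inj₁ p∣k!     = contradiction p∣k! (p∤! k<p)
    ...   | inj₂ p∣[p∸k]! = contradiction p∣[p∸k]! (p∤! (∸-monoʳ-< 0<k (<⇒≤ k<p)))

    -- Fermat's little theorem: xᵖ ≡ x (mod p), by induction on x using the
    -- "freshman's dream" (x + 1)ᵖ ≡ xᵖ + 1.
    fermat : ∀ x → x ^ p ≡ x modulo p
    fermat zero    = cong (λ e → 0 ^ e % p) p≡1+[p∸1]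
    fermat (suc x) = begin
      suc x ^ p % p   ≡⟨ cong (λ y → y ^ p % p) (+-comm 1 x) ⟩
      (x + 1) ^ p % p ≡⟨ inner-binomials⇒freshman p (λ _ → p∣pCk) x ⟩
      (x ^ p + 1) % p ≡⟨ modulo-+ {n = p} (fermat x) refl ⟩
      (x + 1) % p     ≡⟨ cong (_% p) (+-comm x 1) ⟩
      suc x % p       ∎

    -- Fermat's theorem for units: a^(p ∸ 1) ≡ 1 when p ∤ a, obtained by cancelling
    -- a from p ∣ aᵖ ∸ a = a · (a^(p ∸ 1) ∸ 1) with Euclid's lemma.
    fermat-unit : ∀ {a} → ¬ p ∣ a → a ^ (p ∸ 1) ≡ 1 modulo p
    fermat-unit {a} p∤a with euclidsLemma a (a ^ (p ∸ 1) ∸ 1) prime-p p∣a[aᵖ⁻¹∸1]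
      where
      p∣a[aᵖ⁻¹∸1] : p ∣ a * (a ^ (p ∸ 1) ∸ 1)
      p∣a[aᵖ⁻¹∸1] = subst (p ∣_) (begin
        a ^ p ∸ a               ≡⟨ cong₂ (λ e b → a ^ e ∸ b) p≡1+[p∸1] (sym (*-identityʳ a)) ⟩
        a * a ^ (p ∸ 1) ∸ a * 1 ≡⟨ *-distribˡ-∸ a (a ^ (p ∸ 1)) 1 ⟨
        a * (a ^ (p ∸ 1) ∸ 1)   ∎) (modulo⇒∣∸ (fermat a))
    ... | inj₁ p∣a          = contradiction p∣a p∤a
    ... | inj₂ p∣aᵖ⁻¹∸1 = ∣∸⇒modulo (m^n>0 a (p ∸ 1)) p∣aᵖ⁻¹∸1
      where
      instance
        a≢0 : NonZero a
        a≢0 = ≢-nonZero λ { refl → p∤a (divides 0 refl) }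

    fermat-reduce : ∀ {a} → ¬ p ∣ a → ∀ k → a ^ k ≡ a ^ (k % (p ∸ 1)) modulo p
    fermat-reduce {a} p∤a k = begin
      a ^ k % p                 ≡⟨ cong (λ e → a ^ e % p) (m≡m%n+[m/n]*n k (p ∸ 1)) ⟩
      a ^ (r + w * q) % p       ≡⟨ cong (_% p) (^-distribˡ-+-* a r (w * q)) ⟩
      (a ^ r * a ^ (w * q)) % p ≡⟨ cong (λ e → (a ^ r * a ^ e) % p) (*-comm w q) ⟩
      (a ^ r * a ^ (q * w)) % p ≡⟨ cong (λ y → (a ^ r * y) % p) (^-*-assoc a q w) ⟨
      (a ^ r * (a ^ q) ^ w) % p ≡⟨ modulo-* {n = p} {a ^ r} refl (modulo-^ (fermat-unit p∤a) w) ⟩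
      (a ^ r * 1 ^ w) % p       ≡⟨ cong (λ y → (a ^ r * y) % p) (^-zeroˡ w) ⟩
      (a ^ r * 1) % p           ≡⟨ cong (_% p) (*-identityʳ (a ^ r)) ⟩
      a ^ r % p                 ∎
      where
      q r w : ℕ
      q = p ∸ 1
      r = k % q
      w = k / q

    fermat-exponent : ∀ {a k} → ¬ p ∣ a → (p ∸ 1) ∣ k → a ^ k ≡ 1 modulo p
    fermat-exponent {a} {k} p∤a p∸1∣k =
      trans (fermat-reduce p∤a k) (cong (λ e → a ^ e % p) (n∣m⇒m%n≡0 k (p ∸ 1) p∸1∣k))

module Polynomials where

  open import Data.Nat as ℕ using (_≤_; z≤n; s≤s; NonZero; nonTrivial⇒≢1)
  open import Data.Nat.Properties using (≤-total)
  open import Data.Nat.Divisibility using (∣1⇒≡1)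
  open Arithmetic using (_≡_modulo_; modulo⇒∣∸; ∣∸⇒modulo)
  open import Data.Nat.Primality using (euclidsLemma; prime⇒nonZero; prime⇒nonTrivial)
  open import Data.Integer using (ℤ; +_; -_; _+_; _*_; _-_; _⊖_; _^_; ∣_∣)
  open import Data.Integer.Properties
    using (abs-*; +-identityˡ; +-comm; pos-*; m-n≡m⊖n; ∣m⊖n∣≡∣n⊖m∣; ∣⊖∣-≤; ∣i-j∣≡∣j-i∣)
  open import Data.Integer.Tactic.RingSolver using (solve-∀)
  import Data.Integer.Divisibility.Signed as Signed
  open import Data.Fin using (Fin; zero; suc)
  open import Data.Fin.Properties using (suc-injective)
  open import Data.Product using (Σ)
  open import Data.Sum using (_⊎_; inj₁; inj₂)
  open import Relation.Nullary using (¬_; contradiction)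
  open import Relation.Binary.PropositionalEquality
  open ≡-Reasoning

  infix 4 _∣ℤ_
  _∣ℤ_ : ℕ → ℤ → Set
  p ∣ℤ i = p ∣ ∣ i ∣

  -- Polynomial d c f: the function f is a polynomial of degree d with leading
  -- coefficient c, given in Horner form a₀ + x (a₁ + x (⋯ + x c)).
  data Polynomial : ℕ → ℤ → (ℤ → ℤ) → Set where
    constant : ∀ {c f} → (∀ x → f x ≡ c) → Polynomial 0 c f
    horner   : ∀ {d c f g} a → Polynomial d c g → (∀ x → f x ≡ a + x * g x) →
               Polynomial (suc d) c f

  +-lower : ∀ {d c b f g} → Polynomial (suc d) c f → Polynomial d b g → ∀ r →
            Polynomial (suc d) c (λ x → f x + r * g x)
  +-lower {b = b} {f} {g} (horner {g = f′} a P@(constant _) f≡) (constant g≡b) r =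
    horner (a + r * b) P λ x → begin
      f x + r * g x          ≡⟨ cong₂ (λ u v → u + r * v) (f≡ x) (g≡b x) ⟩
      a + x * f′ x + r * b   ≡⟨ regroup a (x * f′ x) (r * b) ⟩
      a + r * b + x * f′ x   ∎
    where
    regroup : ∀ u v w → u + v + w ≡ u + w + v
    regroup = solve-∀
  +-lower {f = f} {g} (horner {g = f′} a P f≡) (horner {g = g′} b Q g≡) r =
    horner (a + r * b) (+-lower P Q r) λ x → begin
      f x + r * g x                   ≡⟨ cong₂ (λ u v → u + r * v) (f≡ x) (g≡ x) ⟩
      a + x * f′ x + r * (b + x * g′ x) ≡⟨ regroup a b r x (f′ x) (g′ x) ⟩
      a + r * b + x * (f′ x + r * g′ x) ∎
    where
    regroup : ∀ a b r x u v → a + x * u + r * (b + x * v) ≡ a + r * b + x * (u + r * v)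
    regroup = solve-∀

  horner-difference : ∀ {a} {f g : ℤ → ℤ} → (∀ x → f x ≡ a + x * g x) → ∀ x r →
                      f x - f r ≡ (x - r) * g x + r * (g x - g r)
  horner-difference {a} {f} {g} f≡ x r = begin
    f x - f r                       ≡⟨ cong₂ _-_ (f≡ x) (f≡ r) ⟩
    a + x * g x - (a + r * g r)     ≡⟨ rearrange a x r (g x) (g r) ⟩
    (x - r) * g x + r * (g x - g r) ∎
    where
    rearrange : ∀ a x r u v → a + x * u - (a + r * v) ≡ (x - r) * u + r * (u - v)
    rearrange = solve-∀

  -- Writing f x = a + x · g x, the difference is
  -- (x − r) · g x + r · (g x − g r), and g x − g r is factored recursively.
  factor : ∀ {d c f} → Polynomial (suc d) c f → ∀ r →
           Σ (ℤ → ℤ) λ q → Polynomial d c q × (∀ x → f x - f r ≡ (x - r) * q x)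
  factor {f = f} (horner {g = g} a G@(constant g≡c) f≡) r = g , G , λ x → begin
    f x - f r                         ≡⟨ horner-difference {a} {g = g} f≡ x r ⟩
    (x - r) * g x + r * (g x - g r)   ≡⟨ cong (λ z → (x - r) * g x + r * (z - g r)) (trans (g≡c x) (sym (g≡c r))) ⟩
    (x - r) * g x + r * (g r - g r)   ≡⟨ cancel (x - r) (g x) r (g r) ⟩
    (x - r) * g x                     ∎
    where
    cancel : ∀ u v r w → u * v + r * (w - w) ≡ u * v
    cancel = solve-∀
  factor {f = f} (horner {g = g} a G@(horner _ _ _) f≡) r with factor G r
  ... | h , H , g-difference = (λ x → g x + r * h x) , +-lower G H r , λ x → begin
    f x - f r                           ≡⟨ horner-difference {a} {g = g} f≡ x r ⟩
    (x - r) * g x + r * (g x - g r)     ≡⟨ cong (λ z → (x - r) * g x + r * z) (g-difference x) ⟩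
    (x - r) * g x + r * ((x - r) * h x) ≡⟨ collect (x - r) (g x) r (h x) ⟩
    (x - r) * (g x + r * h x)           ∎
    where
    collect : ∀ u v r w → u * v + r * (u * w) ≡ u * (v + r * w)
    collect = solve-∀

  power : ∀ n → Polynomial n (+ 1) (_^ n)
  power zero    = constant λ _ → refl
  power (suc n) = horner (+ 0) (power n) λ x → sym (+-identityˡ (x * x ^ n))

  power-minus-one : ∀ n → Polynomial (suc n) (+ 1) (λ x → x ^ suc n - + 1)
  power-minus-one n = horner (- + 1) (power n) λ x → +-comm (x * x ^ n) (- + 1)

  ∣-difference : ∀ {p} i j → p ∣ℤ i → p ∣ℤ j → p ∣ℤ i - j
  ∣-difference {p} i j p∣i p∣j =
    Signed.∣⇒∣ᵤ (Signed.∣m∣n⇒∣m-n {+ p} {i} {j} (Signed.∣ᵤ⇒∣ p∣i) (Signed.∣ᵤ⇒∣ p∣j))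

  ∣+x-+y∣≡x∸y : ∀ {x y} → y ≤ x → ∣ + x - + y ∣ ≡ x ∸ y
  ∣+x-+y∣≡x∸y {x} {y} y≤x = begin
    ∣ + x - + y ∣ ≡⟨ cong ∣_∣ (m-n≡m⊖n x y) ⟩
    ∣ x ⊖ y ∣     ≡⟨ ∣m⊖n∣≡∣n⊖m∣ x y ⟩
    ∣ y ⊖ x ∣     ≡⟨ ∣⊖∣-≤ y≤x ⟩
    x ∸ y         ∎

  module _ {n : ℕ} .{{_ : NonZero n}} where

    modulo⇒∣ℤ : ∀ {x y} → x ≡ y modulo n → n ∣ℤ + x - + y
    modulo⇒∣ℤ {x} {y} x≡y with ≤-total y x
    ... | inj₁ y≤x = subst (n ∣_) (sym (∣+x-+y∣≡x∸y y≤x)) (modulo⇒∣∸ x≡y)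
    ... | inj₂ x≤y = subst (n ∣_) (trans (sym (∣+x-+y∣≡x∸y x≤y)) (∣i-j∣≡∣j-i∣ (+ y) (+ x)))
                       (modulo⇒∣∸ (sym x≡y))

    ∣ℤ⇒modulo : ∀ {x y} → n ∣ℤ + x - + y → x ≡ y modulo n
    ∣ℤ⇒modulo {x} {y} n∣x-y with ≤-total y x
    ... | inj₁ y≤x = ∣∸⇒modulo y≤x (subst (n ∣_) (∣+x-+y∣≡x∸y y≤x) n∣x-y)
    ... | inj₂ x≤y = sym (∣∸⇒modulo x≤y (subst (n ∣_) (trans (∣i-j∣≡∣j-i∣ (+ x) (+ y)) (∣+x-+y∣≡x∸y x≤y))
                                                    n∣x-y))

  pos-^ : ∀ a k → (+ a) ^ k ≡ + (a ℕ.^ k)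
  pos-^ a zero    = refl
  pos-^ a (suc k) = trans (cong ((+ a) *_) (pos-^ a k)) (sym (pos-* a (a ℕ.^ k)))

  module _ {p : ℕ} (prime-p : Prime p) where

    private instance
      p≢0 : NonZero p
      p≢0 = prime⇒nonZero prime-p

    euclidℤ : ∀ i j → p ∣ℤ i * j → p ∣ℤ i ⊎ p ∣ℤ j
    euclidℤ i j p∣ij = euclidsLemma ∣ i ∣ ∣ j ∣ prime-p (subst (p ∣_) (abs-* i j) p∣ij)

    -- Dividing by
    -- x − ρ₀, Euclid's lemma makes every other root a root of the quotient.
    root-bound : ∀ {d c f} → Polynomial d c f → ¬ p ∣ℤ c →
                 ∀ {m} (ρ : Fin m → ℤ) → (∀ i → p ∣ℤ f (ρ i)) →
                 (∀ i j → p ∣ℤ ρ i - ρ j → i ≡ j) → m ≤ d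
    root-bound P p∤c {zero} ρ roots distinct = z≤n
    root-bound (constant f≡c) p∤c {suc m} ρ roots distinct =
      contradiction (subst (p ∣ℤ_) (f≡c (ρ zero)) (roots zero)) p∤c
    root-bound {f = f} P@(horner _ _ _) p∤c {suc m} ρ roots distinct with factor P (ρ zero)
    ... | q , Q , f-difference = s≤s (root-bound Q p∤c (λ i → ρ (suc i)) roots′ distinct′)
      where
      roots′ : ∀ i → p ∣ℤ q (ρ (suc i))
      roots′ i with euclidℤ (ρ (suc i) - ρ zero) (q (ρ (suc i)))
                      (subst (p ∣ℤ_) (f-difference (ρ (suc i)))
                             (∣-difference (f (ρ (suc i))) (f (ρ zero)) (roots (suc i)) (roots zero)))
      ... | inj₁ p∣ρᵢ-ρ₀ = contradiction (distinct (suc i) zero p∣ρᵢ-ρ₀) λ ()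
      ... | inj₂ p∣qρᵢ   = p∣qρᵢ

      distinct′ : ∀ i j → p ∣ℤ ρ (suc i) - ρ (suc j) → i ≡ j
      distinct′ i j p∣ρᵢ-ρⱼ = suc-injective (distinct (suc i) (suc j) p∣ρᵢ-ρⱼ)

    power-root-bound : ∀ r {m} (a : Fin m → ℕ) → (∀ i → a i ℕ.^ suc r ≡ 1 modulo p) →
                       (∀ i j → a i ≡ a j modulo p → i ≡ j) → m ≤ suc r
    power-root-bound r a roots distinct =
      root-bound (power-minus-one r) p∤1 (λ i → + a i) roots′
                 (λ i j p∣aᵢ-aⱼ → distinct i j (∣ℤ⇒modulo p∣aᵢ-aⱼ))
      where
      p∤1 : ¬ p ∣ℤ + 1
      p∤1 p∣1 = nonTrivial⇒≢1 {{prime⇒nonTrivial prime-p}} (∣1⇒≡1 p∣1)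
      roots′ : ∀ i → p ∣ℤ (+ a i) ^ suc r - + 1
      roots′ i = subst (λ z → p ∣ℤ z - + 1) (sym (pos-^ (a i) (suc r))) (modulo⇒∣ℤ (roots i))

module Korselt where

  open import Data.Nat
    using (_+_; _*_; _^_; _%_; s≤s; z<s; NonZero; ≢-nonZero; ≢-nonZero⁻¹)
  open import Data.Nat.Properties
  open import Data.Nat.DivMod using (m%n<n; m%n%n≡m%n; m<n⇒m%n≡m; %-remove-+ʳ; m/n*n≡m)
  open import Data.Nat.Tactic.RingSolver using (solve-∀)
  open import Data.Nat.Divisibility
    using (divides; ∣-refl; ∣-trans; ∣⇒≤; ∣1⇒≡1; m%n≡0⇒n∣m; n∣m⇒m%n≡0; ∣m∣n⇒∣m+n; ∣m+n∣m⇒∣n; ∣n⇒∣m*n; ∣m⇒∣m*n;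
           m*n∣⇒m∣; *-monoʳ-∣; *-cancelˡ-∣; ∣n∣m%n⇒∣m; 1∣_)
  open import Data.Nat.GCD using (gcd; gcd-greatest; gcd-identityˡ)
  open import Data.Nat.LCM using (lcm; lcm-least; gcd*lcm)
  open import Data.Nat.Coprimality using (Coprime; coprime⇒gcd≡1; coprime-divisor)
  open import Data.Nat.Primality using (prime⇒irreducible)
  open import Data.Nat.Primality.Factorisation using (PrimeFactorisation; factorise)
  open import Data.Nat.ListAction using (product)
  open import Data.List.Base using ([]; _∷_)
  open import Data.List.Relation.Unary.All using (All; []; _∷_)
  open import Data.Fin using (Fin; toℕ)
  open import Data.Fin.Properties using (toℕ<n; toℕ-injective)
  open import Data.Sum using (_⊎_; inj₁; inj₂)
  open import Relation.Nullary using (¬_; contradiction)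
  open import Relation.Binary.PropositionalEquality
  open ≡-Reasoning

  open Arithmetic
  open Polynomials using (power-root-bound)

  UnitExponent : (N : ℕ) .{{_ : NonZero N}} → ℕ → Set
  UnitExponent N k = ∀ a → a < N → gcd a N ≡ 1 → a ^ k % N ≡ 1

  unit-power : ∀ {N k b} .{{_ : NonZero N}} → UnitExponent N k → Coprime b N → b ^ k ≡ 1 modulo N
  unit-power {N} {k} {b} exponent b⊥N = begin
    b ^ k % N       ≡⟨ modulo-^ {n = N} (sym (m%n%n≡m%n b N)) k ⟩
    (b % N) ^ k % N ≡⟨ %≡1⇒≡1 (exponent (b % N) (m%n<n b N) (coprime⇒gcd≡1 r⊥N)) ⟩
    1 % N           ∎
    where
    r⊥N : Coprime (b % N) N
    r⊥N (d∣r , d∣N) = b⊥N (∣n∣m%n⇒∣m d∣N d∣r , d∣N)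

  coprime-* : ∀ {a m n} → Coprime a m → Coprime a n → Coprime a (m * n)
  coprime-* {a} {m} a⊥m a⊥n {d} (d∣a , d∣mn) = a⊥n (d∣a , coprime-divisor d⊥m d∣mn)
    where
    d⊥m : Coprime d m
    d⊥m (e∣d , e∣m) = a⊥m (∣-trans e∣d d∣a , e∣m)

  ∣⇒∣^ : ∀ {d m} e .{{_ : NonZero e}} → d ∣ m → d ∣ m ^ e
  ∣⇒∣^ (suc e) d∣m = ∣m⇒∣m*n _ d∣m

  module _ {p : ℕ} (prime-p : Prime p) where
    open ModPrime prime-p

    ∤⇒coprime : ∀ {b} → ¬ p ∣ b → Coprime b p
    ∤⇒coprime p∤b (d∣b , d∣p) with prime⇒irreducible prime-p d∣p
    ... | inj₁ d≡1 = d≡1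
    ... | inj₂ refl = contradiction d∣b p∤b

    -- If every 0 < a < p satisfies aᵏ ≡ 1 (mod p), then p ∸ 1 ∣ k.  Otherwise
    -- r = k mod (p ∸ 1) is positive and, by Fermat, 1, …, p ∸ 1 would be p ∸ 1
    -- incongruent solutions of aʳ ≡ 1, more than Lagrange's bound allows.
    residues⇒p∸1∣ : ∀ {k} → (∀ a → 0 < a → a < p → a ^ k ≡ 1 modulo p) → (p ∸ 1) ∣ k
    residues⇒p∸1∣ {k} killed with k % (p ∸ 1) in k%[p∸1]≡r
    ... | zero  = m%n≡0⇒n∣m k (p ∸ 1) k%[p∸1]≡r
    ... | suc r = contradiction (power-root-bound prime-p r residue roots distinct) (<⇒≱ r<p∸1)
      where
      r<p∸1 : suc r < p ∸ 1
      r<p∸1 = subst (_< p ∸ 1) k%[p∸1]≡r (m%n<n k (p ∸ 1))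

      residue : Fin (p ∸ 1) → ℕ
      residue i = suc (toℕ i)

      residue<p : ∀ i → residue i < p
      residue<p i = subst (residue i <_) (sym p≡1+[p∸1]) (s≤s (toℕ<n i))

      roots : ∀ i → residue i ^ suc r ≡ 1 modulo p
      roots i = begin
        a ^ suc r % p         ≡⟨ cong (λ e → a ^ e % p) k%[p∸1]≡r ⟨
        a ^ (k % (p ∸ 1)) % p ≡⟨ fermat-reduce p∤a k ⟨
        a ^ k % p             ≡⟨ killed a z<s (residue<p i) ⟩
        1 % p                 ∎
        where
        a : ℕ
        a = residue i
        p∤a : ¬ p ∣ a
        p∤a p∣a = <⇒≱ (residue<p i) (∣⇒≤ p∣a)

      distinct : ∀ i j → residue i ≡ residue j modulo p → i ≡ j
      distinct i j residues≡ = toℕ-injective (suc-injective (begin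
        residue i     ≡⟨ m<n⇒m%n≡m (residue<p i) ⟨
        residue i % p ≡⟨ residues≡ ⟩
        residue j % p ≡⟨ m<n⇒m%n≡m (residue<p j) ⟩
        residue j     ∎))

    -- If N = m · p with p ∤ m, every 0 < a < p is congruent modulo p to a unit of
    -- ℤ_N, namely b = 1 + (a ∸ 1) · m^(p ∸ 1): no divisor of m divides b, and
    -- b ≡ a (mod p) by Fermat.
    exponent⇒residues : ∀ {N m k} .{{_ : NonZero N}} → N ≡ m * p → ¬ p ∣ m → UnitExponent N k →
                        ∀ a → 0 < a → a < p → a ^ k ≡ 1 modulo p
    exponent⇒residues {N} {m} {k} N≡mp p∤m exponent (suc i) _ a<p =
      trans (modulo-^ {n = p} (sym b≡a) k) (modulo-∣ (divides m N≡mp) (unit-power {k = k} exponent b⊥N))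
      where
      b : ℕ
      b = 1 + i * m ^ (p ∸ 1)

      b≡a : b ≡ suc i modulo p
      b≡a = begin
        (1 + i * m ^ (p ∸ 1)) % p ≡⟨ modulo-+ {n = p} {1} refl (modulo-* {n = p} {i} refl (fermat-unit p∤m)) ⟩
        (1 + i * 1) % p           ≡⟨ cong (λ z → suc z % p) (*-identityʳ i) ⟩
        suc i % p                 ∎

      b⊥m : Coprime b m
      b⊥m {d} (d∣b , d∣m) =
        ∣1⇒≡1 (∣m+n∣m⇒∣n (subst (d ∣_) (+-comm 1 (i * m ^ (p ∸ 1))) d∣b)
                         (∣n⇒∣m*n i (∣⇒∣^ (p ∸ 1) d∣m)))

      p∤b : ¬ p ∣ b
      p∤b p∣b = 0≢1+n (trans (sym (n∣m⇒m%n≡0 b p p∣b)) (trans b≡a (m<n⇒m%n≡m a<p)))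

      b⊥N : Coprime b N
      b⊥N = subst (Coprime b) (sym N≡mp) (coprime-* b⊥m (∤⇒coprime p∤b))

  exponent⇒p∸1∣ : ∀ {N k} .{{_ : NonZero N}} → SquareFree N → UnitExponent N k →
                  ∀ p → Prime p → p ∣ N → (p ∸ 1) ∣ k
  exponent⇒p∸1∣ {N} {k} squarefree exponent p prime-p (divides m N≡mp) =
    residues⇒p∸1∣ prime-p (exponent⇒residues prime-p {k = k} N≡mp p∤m exponent)
    where
    p∤m : ¬ p ∣ m
    p∤m (divides c m≡cp) = squarefree p (ModPrime.1<p prime-p) (divides c (begin
      N           ≡⟨ N≡mp ⟩
      m * p       ≡⟨ cong (_* p) m≡cp ⟩
      c * p * p   ≡⟨ *-assoc c p p ⟩
      c * (p * p) ∎))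

  unipotent-coprime : ∀ {N t} → N ∣ t * t → Coprime (1 + t) N
  unipotent-coprime {N} {t} N∣t² {d} (d∣1+t , d∣N) =
    ∣1⇒≡1 (∣m+n∣m⇒∣n (subst (d ∣_) (+-comm 1 t) d∣1+t) d∣t)
    where
    d∣t : d ∣ t
    d∣t = ∣m+n∣m⇒∣n (subst (d ∣_) (trans (*-suc t t) (+-comm t (t * t))) (∣n⇒∣m*n t d∣1+t))
                     (∣-trans d∣N N∣t²)

  unipotent-power : ∀ {N t} .{{_ : NonZero N}} → N ∣ t * t → ∀ j → (1 + t) ^ j ≡ 1 + j * t modulo N
  unipotent-power N∣t² zero = refl
  unipotent-power {N} {t} N∣t² (suc j) = begin
    (1 + t) * (1 + t) ^ j % N         ≡⟨ modulo-* {n = N} {1 + t} refl (unipotent-power N∣t² j) ⟩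
    (1 + t) * (1 + j * t) % N         ≡⟨ cong (_% N) (expand t j) ⟩
    (1 + suc j * t + j * (t * t)) % N ≡⟨ %-remove-+ʳ (1 + suc j * t) (∣n⇒∣m*n j N∣t²) ⟩
    (1 + suc j * t) % N               ∎
    where
    expand : ∀ t j → (1 + t) * (1 + j * t) ≡ 1 + (t + j * t) + j * (t * t)
    expand = solve-∀

  -- If d² ∣ N then d divides every exponent k of U(ℤ_N): writing N = t · d, the
  -- unit 1 + t gives 1 ≡ (1 + t)ᵏ ≡ 1 + k · t (mod N), so t · d ∣ t · k.
  square∣⇒∣exponent : ∀ {N k d} .{{_ : NonZero N}} → UnitExponent N k → d * d ∣ N → d ∣ k
  square∣⇒∣exponent {N} {k} {d} exponent (divides s N≡s[dd]) = *-cancelˡ-∣ t (subst (_∣ t * k) N≡td N∣tk)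
    where
    t : ℕ
    t = s * d

    N≡td : N ≡ t * d
    N≡td = trans N≡s[dd] (sym (*-assoc s d d))

    instance
      t≢0 : NonZero t
      t≢0 = ≢-nonZero λ t≡0 → ≢-nonZero⁻¹ N (trans N≡td (cong (_* d) t≡0))

    N∣t² : N ∣ t * t
    N∣t² = divides s (begin
      s * d * (s * d)   ≡⟨ regroup s d ⟩
      s * (s * (d * d)) ≡⟨ cong (s *_) N≡s[dd] ⟨
      s * N             ∎)
      where
      regroup : ∀ s d → s * d * (s * d) ≡ s * (s * (d * d))
      regroup = solve-∀

    N∣tk : N ∣ t * k
    N∣tk = subst (N ∣_) (trans (m+n∸m≡n 1 (k * t)) (*-comm k t))
             (modulo⇒∣∸ (trans (sym (unipotent-power N∣t² k)) (unit-power {k = k} exponent (unipotent-coprime N∣t²))))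

  parity : ∀ n → 2 ∣ n ⊎ 2 ∣ suc n
  parity zero    = inj₁ (divides 0 refl)
  parity (suc n) with parity n
  ... | inj₁ 2∣n   = inj₂ (∣m∣n⇒∣m+n (∣-refl {2}) 2∣n)
  ... | inj₂ 2∣1+n = inj₁ 2∣1+n

  odd⇒n≡[n/2]*2 : ∀ n → Odd (suc n) → n ≡ n / 2 * 2
  odd⇒n≡[n/2]*2 n odd with parity n
  ... | inj₁ 2∣n   = sym (m/n*n≡m 2∣n)
  ... | inj₂ 2∣1+n = contradiction 2∣1+n odd

  -- An odd N = 2k + 1 whose units have exponent k is squarefree: a square divisor
  -- d² ∣ N gives d ∣ k, so d divides both 2k and 2k + 1, and d = 1.
  exponent⇒squarefree : ∀ n → Odd (suc n) → UnitExponent (suc n) (n / 2) → SquareFree (suc n)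
  exponent⇒squarefree n odd exponent d 1<d d²∣N = <⇒≢ 1<d (sym (∣1⇒≡1 d∣1))
    where
    d∣n : d ∣ n
    d∣n = subst (d ∣_) (sym (odd⇒n≡[n/2]*2 n odd)) (∣m⇒∣m*n 2 (square∣⇒∣exponent {k = n / 2} exponent d²∣N))
    d∣1 : d ∣ 1
    d∣1 = ∣m+n∣m⇒∣n (subst (d ∣_) (+-comm 1 n) (m*n∣⇒m∣ d d d²∣N)) d∣n

  -- Coprime divisors of M divide M jointly, since their lcm is their product.
  coprime-∣ : ∀ {m n M} → Coprime m n → m ∣ M → n ∣ M → m * n ∣ M
  coprime-∣ {m} {n} m⊥n m∣M n∣M = subst (_∣ _) lcm≡mn (lcm-least m∣M n∣M)
    where
    lcm≡mn : lcm m n ≡ m * n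
    lcm≡mn = begin
      lcm m n            ≡⟨ *-identityˡ (lcm m n) ⟨
      1 * lcm m n        ≡⟨ cong (_* lcm m n) (coprime⇒gcd≡1 m⊥n) ⟨
      gcd m n * lcm m n  ≡⟨ gcd*lcm m n ⟩
      m * n              ∎

  -- A squarefree product of primes divides M as soon as each of its prime
  -- divisors does: its factors are distinct primes, hence pairwise coprime.
  primes-∣ : ∀ {M} ps → All Prime ps → SquareFree (product ps) →
             (∀ p → Prime p → p ∣ product ps → p ∣ M) → product ps ∣ M
  primes-∣ {M} []       _                  _          _   = 1∣ M
  primes-∣ {M} (p ∷ ps) (prime-p ∷ primes) squarefree p∣M =
    subst (_∣ M) (*-comm P p) (coprime-∣ (∤⇒coprime prime-p p∤P) P∣M (p∣M p prime-p (∣m⇒∣m*n P ∣-refl)))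
    where
    P : ℕ
    P = product ps
    p∤P : ¬ p ∣ P
    p∤P p∣P = squarefree p (ModPrime.1<p prime-p) (*-monoʳ-∣ p p∣P)
    P∣M : P ∣ M
    P∣M = primes-∣ ps primes (λ d 1<d d²∣P → squarefree d 1<d (∣n⇒∣m*n p d²∣P))
                   (λ q prime-q q∣P → p∣M q prime-q (∣n⇒∣m*n p q∣P))

  squarefree-∣ : ∀ {N M} .{{_ : NonZero N}} → SquareFree N → (∀ p → Prime p → p ∣ N → p ∣ M) → N ∣ M
  squarefree-∣ {N} {M} squarefree p∣M =
    subst (_∣ M) (sym N≡∏) (primes-∣ factors factorsPrime (subst SquareFree N≡∏ squarefree)
                                      (λ p prime-p p∣∏ → p∣M p prime-p (subst (p ∣_) (sym N≡∏) p∣∏)))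
    where
    open PrimeFactorisation (factorise N) renaming (isFactorisation to N≡∏)

  -- For a unit a, Fermat
  -- makes every prime divisor of N divide aᵏ ∸ 1, hence N divides it.
  p∸1∣⇒exponent : ∀ {N k} .{{_ : NonZero N}} → 1 < N → SquareFree N →
                  (∀ p → Prime p → p ∣ N → (p ∸ 1) ∣ k) → UnitExponent N k
  p∸1∣⇒exponent {N} {k} 1<N squarefree p∸1∣k a a<N gcd≡1 = begin
    a ^ k % N ≡⟨ ∣∸⇒modulo (m^n>0 a k) (squarefree-∣ squarefree p∣aᵏ∸1) ⟩
    1 % N     ≡⟨ m<n⇒m%n≡m 1<N ⟩
    1         ∎
    where
    instance
      a≢0 : NonZero a
      a≢0 = ≢-nonZero λ { refl → <⇒≢ 1<N (trans (sym gcd≡1) (gcd-identityˡ N)) }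

    p∣aᵏ∸1 : ∀ p → Prime p → p ∣ N → p ∣ a ^ k ∸ 1
    p∣aᵏ∸1 p prime-p p∣N = modulo⇒∣∸ (fermat-exponent p∤a (p∸1∣k p prime-p p∣N))
      where
      open ModPrime prime-p
      p∤a : ¬ p ∣ a
      p∤a p∣a = p∤1 (subst (p ∣_) gcd≡1 (gcd-greatest p∣a p∣N))

open Korselt using (exponent⇒squarefree; exponent⇒p∸1∣; p∸1∣⇒exponent)

proposition3p2 : (n : ℕ) → Composite n →
    SpecialCarmichael n ⇔ (Odd n × SquareFree n × (∀ p → Prime p → p ∣ n → (p ∸ 1) ∣ ((n ∸ 1) / 2)))
proposition3p2 zero    (hasNonTrivialDivisor () _)
proposition3p2 (suc n) N-composite = mk⇔ necessary sufficient
  where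
  Korselt-conditions : Set
  Korselt-conditions = Odd (suc n) × SquareFree (suc n) × (∀ p → Prime p → p ∣ suc n → (p ∸ 1) ∣ (n / 2))

  necessary : SpecialCarmichael (suc n) → Korselt-conditions
  necessary (odd , _ , exponent) = odd , squarefree , exponent⇒p∸1∣ squarefree exponent
    where
    squarefree : SquareFree (suc n)
    squarefree = exponent⇒squarefree n odd exponent

  sufficient : Korselt-conditions → SpecialCarmichael (suc n)
  sufficient (odd , squarefree , p∸1∣k) = odd , N-composite , p∸1∣⇒exponent 1<N squarefree p∸1∣k
    where
    1<N : 1 < suc n
    1<N = nonTrivial⇒n>1 (suc n) {{composite⇒nonTrivial N-composite}}
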